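{- Let $k_1 \le k$ be positive integers. Let $\delta = \frac{97}{420}$ and $\phi = 1.86 - \frac{1}{2100}$. Let $\beta(k) = 0$ for $k = 0, \dots, 8$ and $\beta(k) = \frac{1}{3} - \delta$ for $k \ge 9$. Then the following inequalities hold: \begin{enumerate} \item[(a)] $(k-1)H_2 + 2H_{k+1} \le (k+1)\phi - \beta(k) - \delta$; \item[(b)] $-(k-k_1-1)\delta + k_1 H_2 + H_{k+1} + \sum_{j=1}^{k-1}\left(\frac{2}{8+j} - \frac{1}{8}\right) + \frac{k_1}{8} < (k_1+1)\phi - \beta(k)$; \item[(c)] $-(k-1)\delta + H_{k+1} + k_1\phi + \sum_{j=1}^{k-1}\frac{1}{16+j} < (k_1+1)\phi - \beta(k)$. \end{enumerate}
   Context: For a nonnegative integer $n$, $H_n = \sum_{i=1}^{n} \frac{1}{i}$ denotes the $n$-th harmonic number (with $H_0 = 0$). Empty sums are $0$. -}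

module Defs where

open import Data.Nat as ℕ using (ℕ; zero; suc; _≤ᵇ_)
open import Data.Integer as ℤ using (ℤ; +_)
open import Data.Bool using (if_then_else_)
open import Data.Rational using (ℚ; _/_; _+_; _-_; _*_; 0ℚ)

ι : ℕ → ℚ
ι n = + n / 1

ιℤ : ℤ → ℚ
ιℤ z = z / 1

H : ℕ → ℚ
H zero    = 0ℚ
H (suc n) = H n + (+ 1 / suc n)

Σ₁ : ℕ → (ℕ → ℚ) → ℚ
Σ₁ zero    f = 0ℚ
Σ₁ (suc n) f = Σ₁ n f + f (suc n)

δ : ℚ
δ = + 97 / 420

φ : ℚ
φ = (+ 186 / 100) - (+ 1 / 2100)

β : ℕ → ℚ
β k = if k ≤ᵇ 8 then 0ℚ else ((+ 1 / 3) - δ)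

-- Write k = m + 1 and k₁ = j + 1. Each unit of j adds at most φ to the left-hand
-- sides of (b) and (c) and exactly φ to their right-hand sides, so it suffices to
-- treat k₁ = 1, leaving three inequalities in m alone. They are checked by
-- computation for m ≤ 8. From m = 8 on β is constant, and a step in m raises the
-- left-hand sides by H₂ + 2/(m+3), 1/(m+3) + 2/(m+9) − 1/8 − δ and
-- 1/(m+3) + 1/(m+17) − δ respectively: decreasing in m, and at m = 8 already no
-- larger than the growth φ, 0, 0 of the right-hand sides.
module Submission where

open import Defs
open import Data.Nat using (ℕ; suc; _≤_; _∸_) renaming (_+_ to _+ℕ_)
open import Data.Integer using (+_) renaming (_-_ to _-ℤ_)
open import Data.Product using (_×_)
open import Data.Rational using (ℚ; _/_; _+_; _-_; _*_; -_; _<_) renaming (_≤_ to _≤ℚ_)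

open import Data.Product using (_,_)
open import Data.Sum using (inj₁; inj₂)
open import Data.Unit using (tt)
open import Data.Nat using (zero; s≤s; z≤n)
import Data.Nat.Properties as ℕ
import Data.Integer as ℤ
import Data.Integer.Properties as ℤ
open import Data.Fin using (Fin; toℕ; fromℕ; fromℕ<)
open import Data.Fin.Properties using (all?; toℕ-fromℕ; toℕ-fromℕ<)
open import Data.Rational using (0ℚ; 1ℚ; toℚᵘ)
open import Data.Rational.Properties
import Data.Rational.Unnormalised as ℚᵘ
import Data.Rational.Unnormalised.Properties as ℚᵘ
open import Data.Rational.Solver using (module +-*-Solver)
open +-*-Solver
open import Relation.Binary.PropositionalEquality
open import Relation.Nullary.Decidable using (toWitness)

ιℤ-toℚᵘ : ∀ z → toℚᵘ (ιℤ z) ℚᵘ.≃ ℚᵘ.mkℚᵘ z 0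
ιℤ-toℚᵘ z = toℚᵘ-fromℚᵘ (ℚᵘ.mkℚᵘ z 0)

ιℤ-homo-+ : ∀ a b → ιℤ (a ℤ.+ b) ≡ ιℤ a + ιℤ b
ιℤ-homo-+ a b = toℚᵘ-injective (ℚᵘ.≃-trans (ιℤ-toℚᵘ (a ℤ.+ b)) (ℚᵘ.≃-trans mkℚᵘ-homo-+
   (ℚᵘ.≃-sym (ℚᵘ.≃-trans (toℚᵘ-homo-+ (ιℤ a) (ιℤ b)) (ℚᵘ.+-cong (ιℤ-toℚᵘ a) (ιℤ-toℚᵘ b))))))
  where
  mkℚᵘ-homo-+ : ℚᵘ.mkℚᵘ (a ℤ.+ b) 0 ℚᵘ.≃ ℚᵘ.mkℚᵘ a 0 ℚᵘ.+ ℚᵘ.mkℚᵘ b 0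
  mkℚᵘ-homo-+ = ℚᵘ.*≡* (cong (ℤ._* + 1) (sym (cong₂ ℤ._+_ (ℤ.*-identityʳ a) (ℤ.*-identityʳ b))))

ιℤ-homo‿- : ∀ a → ιℤ (ℤ.- a) ≡ - ιℤ a
ιℤ-homo‿- a = toℚᵘ-injective (ℚᵘ.≃-trans (ιℤ-toℚᵘ (ℤ.- a))
   (ℚᵘ.≃-sym (ℚᵘ.≃-trans (toℚᵘ-homo‿- (ιℤ a)) (ℚᵘ.-‿cong (ιℤ-toℚᵘ a)))))

ιℤ-homo-− : ∀ a b → ιℤ (a -ℤ b) ≡ ιℤ a - ιℤ b
ιℤ-homo-− a b = trans (ιℤ-homo-+ a (ℤ.- b)) (cong (λ x → ιℤ a + x) (ιℤ-homo‿- b))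

ι-suc : ∀ n → ι (suc n) ≡ ι n + 1ℚ
ι-suc n = trans (cong ιℤ (cong +_ (ℕ.+-comm 1 n))) (ιℤ-homo-+ (+ n) (+ 1))

/-antimonoʳ-≤ : ∀ p {a b} → a ≤ b → + suc p / suc b ≤ℚ + suc p / suc a
/-antimonoʳ-≤ p {a} {b} a≤b = toℚᵘ-cancel-≤
  (ℚᵘ.≤-respˡ-≃ (ℚᵘ.≃-sym (toℚᵘ-fromℚᵘ (ℚᵘ.mkℚᵘ (+ suc p) b)))
  (ℚᵘ.≤-respʳ-≃ (ℚᵘ.≃-sym (toℚᵘ-fromℚᵘ (ℚᵘ.mkℚᵘ (+ suc p) a)))
   (ℚᵘ.*≤* (ℤ.+≤+ (ℕ.*-monoʳ-≤ (suc p) (s≤s a≤b))))))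

x+[y-x]≡y : ∀ x y → x + (y - x) ≡ y
x+[y-x]≡y = solve 2 (λ x y → x :+ (y :- x) := y) refl

module _ {_∼_ : ℚ → ℚ → Set}
         (∼-+-mono : ∀ {x y a b} → x ∼ y → a ≤ℚ b → (x + a) ∼ (y + b))
         (f g : ℕ → ℚ) (n₀ : ℕ)
         (initial : ∀ (i : Fin (suc n₀)) → f (toℕ i) ∼ g (toℕ i))
         (increments : ∀ d → f (suc (n₀ +ℕ d)) - f (n₀ +ℕ d) ≤ℚ g (suc (n₀ +ℕ d)) - g (n₀ +ℕ d))
  where

  private
    tail : ∀ d → f (n₀ +ℕ d) ∼ g (n₀ +ℕ d)
    tail zero = subst (λ n → f n ∼ g n) (trans (toℕ-fromℕ n₀) (sym (ℕ.+-identityʳ n₀))) (initial (fromℕ n₀))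
    tail (suc d) = subst (λ n → f n ∼ g n) (sym (ℕ.+-suc n₀ d))
      (subst₂ _∼_ (x+[y-x]≡y (f n) (f (suc n))) (x+[y-x]≡y (g n) (g (suc n)))
        (∼-+-mono (tail d) (increments d)))
      where n = n₀ +ℕ d

  by-increments : ∀ n → f n ∼ g n
  by-increments n with ℕ.≤-total n n₀
  ... | inj₁ n≤n₀ = subst (λ m → f m ∼ g m) (toℕ-fromℕ< (s≤s n≤n₀)) (initial (fromℕ< (s≤s n≤n₀)))
  ... | inj₂ n₀≤n = subst (λ m → f m ∼ g m) (ℕ.m+[n∸m]≡n n₀≤n) (tail (n ∸ n₀))

β-tail : ℚ
β-tail = + 1 / 3 - δ

lhsA rhsA : ℕ → ℚ
lhsA m = ι m * H 2 + ι 2 * H (suc (suc m))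
rhsA m = ι (suc (suc m)) * φ - β (suc m) - δ

lhsA-increment : ∀ m → lhsA (suc m) - lhsA m ≡ H 2 + ι 2 * (+ 1 / suc (suc (suc m)))
lhsA-increment m = trans (cong (λ a → a * H 2 + ι 2 * (h + r) - lhsA m) (ι-suc m))
  (solve 3 (λ a h r → (a :+ con 1ℚ) :* con (H 2) :+ con (ι 2) :* (h :+ r)
                        :- (a :* con (H 2) :+ con (ι 2) :* h)
                      := con (H 2) :+ con (ι 2) :* r) refl (ι m) h r)
  where
  h = H (suc (suc m))
  r = + 1 / suc (suc (suc m))

rhsA-increment : ∀ d → rhsA (9 +ℕ d) - rhsA (8 +ℕ d) ≡ φ
rhsA-increment d = trans (cong (λ b → b * φ - β-tail - δ - rhsA (8 +ℕ d)) (ι-suc (10 +ℕ d)))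
  (solve 1 (λ b → (b :+ con 1ℚ) :* con φ :- con β-tail :- con δ
                   :- (b :* con φ :- con β-tail :- con δ) := con φ) refl (ι (10 +ℕ d)))

lhsA≤rhsA : ∀ m → lhsA m ≤ℚ rhsA m
lhsA≤rhsA = by-increments {_∼_ = _≤ℚ_} +-mono-≤ lhsA rhsA 8
  (toWitness {a? = all? (λ i → lhsA (toℕ i) ≤? rhsA (toℕ i))} tt) increment
  where
  open ≤-Reasoning
  increment : ∀ d → lhsA (9 +ℕ d) - lhsA (8 +ℕ d) ≤ℚ rhsA (9 +ℕ d) - rhsA (8 +ℕ d)
  increment d = begin
    lhsA (9 +ℕ d) - lhsA (8 +ℕ d)  ≡⟨ lhsA-increment (8 +ℕ d) ⟩
    H 2 + ι 2 * (+ 1 / (11 +ℕ d))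
      ≤⟨ +-monoʳ-≤ (H 2) (*-monoˡ-≤-nonNeg (ι 2) (/-antimonoʳ-≤ 0 (ℕ.m≤m+n 10 d))) ⟩
    H 2 + ι 2 * (+ 1 / 11)         ≤⟨ toWitness {a? = H 2 + ι 2 * (+ 1 / 11) ≤? φ} tt ⟩
    φ                              ≡⟨ sym (rhsA-increment d) ⟩
    rhsA (9 +ℕ d) - rhsA (8 +ℕ d)  ∎

drift : (ℕ → ℚ) → ℕ → ℚ
drift f m = - (ι m * δ) + H (suc (suc m)) + Σ₁ m f

drift-increment : ∀ f m → drift f (suc m) - drift f m ≡ + 1 / suc (suc (suc m)) + f (suc m) - δ
drift-increment f m = trans (cong (λ a → - (a * δ) + (h + r) + (s + f (suc m)) - drift f m) (ι-suc m))
  (solve 5 (λ a h r s y → :- ((a :+ con 1ℚ) :* con δ) :+ (h :+ r) :+ (s :+ y)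
                           :- (:- (a :* con δ) :+ h :+ s)
                         := r :+ y :- con δ) refl (ι m) h r s (f (suc m)))
  where
  h = H (suc (suc m))
  r = + 1 / suc (suc (suc m))
  s = Σ₁ m f

summandC : ℕ → ℚ
summandC j = + 1 / (16 +ℕ j)

rhsC : ℕ → ℚ
rhsC m = φ - β (suc m)

drift<rhsC : ∀ m → drift summandC m < rhsC m
drift<rhsC = by-increments {_∼_ = _<_} +-mono-<-≤ (drift summandC) rhsC 8
  (toWitness {a? = all? (λ i → drift summandC (toℕ i) <? rhsC (toℕ i))} tt) increment
  where
  open ≤-Reasoning
  increment : ∀ d → drift summandC (9 +ℕ d) - drift summandC (8 +ℕ d) ≤ℚ rhsC (9 +ℕ d) - rhsC (8 +ℕ d)
  increment d = begin
    drift summandC (9 +ℕ d) - drift summandC (8 +ℕ d)  ≡⟨ drift-increment summandC (8 +ℕ d) ⟩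
    + 1 / (11 +ℕ d) + + 1 / (25 +ℕ d) - δ
      ≤⟨ +-monoˡ-≤ (- δ) (+-mono-≤ (/-antimonoʳ-≤ 0 (ℕ.m≤m+n 10 d)) (/-antimonoʳ-≤ 0 (ℕ.m≤m+n 24 d))) ⟩
    + 1 / 11 + + 1 / 25 - δ         ≤⟨ toWitness {a? = + 1 / 11 + + 1 / 25 - δ ≤? 0ℚ} tt ⟩
    0ℚ                              ≡⟨ sym (+-inverseʳ (rhsC (8 +ℕ d))) ⟩
    rhsC (9 +ℕ d) - rhsC (8 +ℕ d)  ∎

summandB : ℕ → ℚ
summandB j = + 2 / (8 +ℕ j) - + 1 / 8

-- the contribution of each unit of k₁ to the left-hand side of (b)
unitB : ℚ
unitB = δ + H 2 + + 1 / 8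

lhsB rhsB : ℕ → ℚ
lhsB m = drift summandB m + unitB
rhsB m = ι 2 * φ - β (suc m)

lhsB<rhsB : ∀ m → lhsB m < rhsB m
lhsB<rhsB = by-increments {_∼_ = _<_} +-mono-<-≤ lhsB rhsB 8
  (toWitness {a? = all? (λ i → lhsB (toℕ i) <? rhsB (toℕ i))} tt) increment
  where
  open ≤-Reasoning
  increment : ∀ d → lhsB (9 +ℕ d) - lhsB (8 +ℕ d) ≤ℚ rhsB (9 +ℕ d) - rhsB (8 +ℕ d)
  increment d = begin
    lhsB (9 +ℕ d) - lhsB (8 +ℕ d)
      ≡⟨ solve 3 (λ x y c → (x :+ c) :- (y :+ c) := x :- y) refl
           (drift summandB (9 +ℕ d)) (drift summandB (8 +ℕ d)) unitB ⟩
    drift summandB (9 +ℕ d) - drift summandB (8 +ℕ d)  ≡⟨ drift-increment summandB (8 +ℕ d) ⟩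
    + 1 / (11 +ℕ d) + (+ 2 / (17 +ℕ d) - + 1 / 8) - δ
      ≤⟨ +-monoˡ-≤ (- δ) (+-mono-≤ (/-antimonoʳ-≤ 0 (ℕ.m≤m+n 10 d))
                                     (+-monoˡ-≤ (- (+ 1 / 8)) (/-antimonoʳ-≤ 1 (ℕ.m≤m+n 16 d)))) ⟩
    + 1 / 11 + (+ 2 / 17 - + 1 / 8) - δ  ≤⟨ toWitness {a? = + 1 / 11 + (+ 2 / 17 - + 1 / 8) - δ ≤? 0ℚ} tt ⟩
    0ℚ                              ≡⟨ sym (+-inverseʳ (rhsB (8 +ℕ d))) ⟩
    rhsB (9 +ℕ d) - rhsB (8 +ℕ d)  ∎

partC : ∀ j m → - (ι m * δ) + H (suc (suc m)) + ι (suc j) * φ + Σ₁ m summandC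
                < ι (suc (suc j)) * φ - β (suc m)
partC j m = subst₂ _<_ lhs-eq rhs-eq (+-monoˡ-< (ι (suc j) * φ) (drift<rhsC m))
  where
  lhs-eq : drift summandC m + ι (suc j) * φ
         ≡ - (ι m * δ) + H (suc (suc m)) + ι (suc j) * φ + Σ₁ m summandC
  lhs-eq = solve 4 (λ x h a s → :- (x :* con δ) :+ h :+ s :+ a :* con φ
                                := :- (x :* con δ) :+ h :+ a :* con φ :+ s)
             refl (ι m) (H (suc (suc m))) (ι (suc j)) (Σ₁ m summandC)
  rhs-eq : rhsC m + ι (suc j) * φ ≡ ι (suc (suc j)) * φ - β (suc m)
  rhs-eq = trans (solve 2 (λ a b → con φ :- b :+ a :* con φ := (a :+ con 1ℚ) :* con φ :- b)
                    refl (ι (suc j)) (β (suc m)))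
                 (cong (λ a → a * φ - β (suc m)) (sym (ι-suc (suc j))))

partB : ∀ j m → - (ιℤ (+ suc m -ℤ + suc j -ℤ + 1) * δ) + ι (suc j) * H 2 + H (suc (suc m))
                  + Σ₁ m summandB + ι (suc j) * (+ 1 / 8)
                < ι (suc (suc j)) * φ - β (suc m)
partB j m = subst₂ _<_ lhs-eq rhs-eq
  (+-mono-<-≤ (lhsB<rhsB m) (*-monoˡ-≤-nonNeg (ι j) {{normalize-nonNeg j 1}} unitB≤φ))
  where
  unitB≤φ : unitB ≤ℚ φ
  unitB≤φ = toWitness {a? = unitB ≤? φ} tt
  coefficient : ιℤ (+ suc m -ℤ + suc j -ℤ + 1) ≡ (ι m + 1ℚ) - (ι j + 1ℚ) - 1ℚ
  coefficient = trans (ιℤ-homo-− (+ suc m -ℤ + suc j) (+ 1))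
    (cong (_- 1ℚ) (trans (ιℤ-homo-− (+ suc m) (+ suc j)) (cong₂ _-_ (ι-suc m) (ι-suc j))))
  lhs-eq : lhsB m + ι j * unitB
         ≡ - (ιℤ (+ suc m -ℤ + suc j -ℤ + 1) * δ) + ι (suc j) * H 2 + H (suc (suc m))
             + Σ₁ m summandB + ι (suc j) * (+ 1 / 8)
  lhs-eq = trans
    (solve 4 (λ x y h s → :- (x :* con δ) :+ h :+ s :+ con unitB :+ y :* con unitB
       := :- (((x :+ con 1ℚ) :- (y :+ con 1ℚ) :- con 1ℚ) :* con δ) :+ (y :+ con 1ℚ) :* con (H 2) :+ h
            :+ s :+ (y :+ con 1ℚ) :* con (+ 1 / 8))
       refl (ι m) (ι j) (H (suc (suc m))) (Σ₁ m summandB))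
    (cong₂ (λ c a → - (c * δ) + a * H 2 + H (suc (suc m)) + Σ₁ m summandB + a * (+ 1 / 8))
           (sym coefficient) (sym (ι-suc j)))
  rhs-eq : rhsB m + ι j * φ ≡ ι (suc (suc j)) * φ - β (suc m)
  rhs-eq = trans (solve 2 (λ y b → con (ι 2) :* con φ :- b :+ y :* con φ
                                  := ((y :+ con 1ℚ) :+ con 1ℚ) :* con φ :- b) refl (ι j) (β (suc m)))
                 (cong (λ a → a * φ - β (suc m)) (sym (trans (ι-suc (suc j)) (cong (_+ 1ℚ) (ι-suc j)))))

mainTheorem4 : (k₁ k : ℕ) → 1 ≤ k₁ → k₁ ≤ k →
    (ι (k ∸ 1) * H 2 + ι 2 * H (suc k) ≤ℚ ι (suc k) * φ - β k - δ)
    × (- (ιℤ (+ k -ℤ + k₁ -ℤ + 1) * δ) + ι k₁ * H 2 + H (suc k)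
         + Σ₁ (k ∸ 1) (λ j → + 2 / (8 +ℕ j) - + 1 / 8) + ι k₁ * (+ 1 / 8)
       < ι (suc k₁) * φ - β k)
    × (- (ι (k ∸ 1) * δ) + H (suc k) + ι k₁ * φ + Σ₁ (k ∸ 1) (λ j → + 1 / (16 +ℕ j))
       < ι (suc k₁) * φ - β k)
mainTheorem4 (suc j) (suc m) (s≤s z≤n) _ = lhsA≤rhsA m , partB j m , partC j m
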